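{- Let $K$ be a field of characteristic zero, let $P$ be a delta operator on $K[x]$ with basic sequence $(s_n(x))_{n\ge0}$, and let $U_P$ be the linear operator on $K[x]$ with $U_Ps_n(x)=x^n$. Then $$U_P=\sum_{k=0}^\infty X^k(P-D)^k/k!.$$
   Context: $D$ is differentiation and $X$ multiplication by $x$. A delta operator is a linear operator $P$ on $K[x]$ commuting with all shifts $E^ap(x)=p(x+a)$ ($a\in K$) and degree reducing ($\deg(Pp)+1=\deg p$ for nonconstant $p$, $P$ kills constants). Its basic sequence is the unique polynomial sequence with $s_0=1$, $s_n(0)=0$ for $n\ge1$, and $Ps_n=ns_{n-1}$ (equivalently $s_n=n!\,p_n$ where $Pp_n=p_{n-1}$, $p_n(0)=\delta_{n0}$). -}

module Defs where

open import Level using (Level; _⊔_) renaming (suc to lsuc)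
open import Algebra.Bundles using (CommutativeRing)
open import Data.Nat using (ℕ; zero; suc; _<_)
open import Data.List using (List; []; _∷_; map)
open import Data.Product using (_×_)
open import Relation.Nullary using (¬_)

record Field (c ℓ : Level) : Set (lsuc (c ⊔ ℓ)) where
  field
    commutativeRing : CommutativeRing c ℓ
  open CommutativeRing commutativeRing public
  field
    inv     : (x : Carrier) → ¬ (x ≈ 0#) → Carrier
    inverse : ∀ x (nz : ¬ (x ≈ 0#)) → (x * inv x nz) ≈ 1#
    0≉1     : ¬ (0# ≈ 1#)

module Poly {c ℓ : Level} (F : Field c ℓ) where
  open Field F

  natK : ℕ → Carrier
  natK zero    = 0#
  natK (suc n) = 1# + natK n

  CharZero : Set ℓ
  CharZero = ∀ n → ¬ (natK (suc n) ≈ 0#)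

  invFact : CharZero → ℕ → Carrier
  invFact χ zero    = 1#
  invFact χ (suc k) = invFact χ k * inv (natK (suc k)) (χ k)

  -- polynomials in K[x] as coefficient lists, lowest degree first;
  -- trailing zeros are allowed, equality is coefficientwise.
  Pol : Set c
  Pol = List Carrier

  coeff : Pol → ℕ → Carrier
  coeff []       n       = 0#
  coeff (a ∷ as) zero    = a
  coeff (a ∷ as) (suc n) = coeff as n

  infix 4 _≈ₚ_
  _≈ₚ_ : Pol → Pol → Set ℓ
  p ≈ₚ q = ∀ n → coeff p n ≈ coeff q n

  infixl 6 _+ₚ_
  _+ₚ_ : Pol → Pol → Pol
  []       +ₚ q        = q
  (a ∷ as) +ₚ []       = a ∷ as
  (a ∷ as) +ₚ (b ∷ bs) = (a + b) ∷ (as +ₚ bs)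

  scale : Carrier → Pol → Pol
  scale a p = map (a *_) p

  negₚ : Pol → Pol
  negₚ p = map -_ p

  mono : ℕ → Pol
  mono zero    = 1# ∷ []
  mono (suc n) = 0# ∷ mono n

  Op : Set c
  Op = Pol → Pol

  X : Op
  X p = 0# ∷ p

  deriv′ : ℕ → Pol → Pol
  deriv′ k []       = []
  deriv′ k (a ∷ as) = (natK k * a) ∷ deriv′ (suc k) as

  D : Op
  D []       = []
  D (a ∷ as) = deriv′ 1 as

  -- shift E^a : p(x) ↦ p(x + a)  (Horner scheme)
  shift : Carrier → Op
  shift a []       = []
  shift a (b ∷ bs) = (b ∷ []) +ₚ (X (shift a bs) +ₚ scale a (shift a bs))

  iter : Op → ℕ → Op
  iter T zero    p = p
  iter T (suc k) p = T (iter T k p)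

  sumₚ : ℕ → (ℕ → Pol) → Pol
  sumₚ zero    f = []
  sumₚ (suc N) f = sumₚ N f +ₚ f N

  _−ₒ_ : Op → Op → Op
  (S −ₒ T) p = S p +ₚ negₚ (T p)

  record IsLinear (T : Op) : Set (c ⊔ ℓ) where
    field
      cong-≈ₚ : ∀ p q → p ≈ₚ q → T p ≈ₚ T q
      additive : ∀ p q → T (p +ₚ q) ≈ₚ T p +ₚ T q
      homog    : ∀ a p → T (scale a p) ≈ₚ scale a (T p)

  HasDeg : Pol → ℕ → Set ℓ
  HasDeg p n = ¬ (coeff p n ≈ 0#) × (∀ m → n < m → coeff p m ≈ 0#)

  record IsDelta (P : Op) : Set (c ⊔ ℓ) where
    field
      linear     : IsLinear P
      shiftInv   : ∀ a p → P (shift a p) ≈ₚ shift a (P p)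
      degReduce  : ∀ p n → HasDeg p (suc n) → HasDeg (P p) n
      killsConst : ∀ a → P (a ∷ []) ≈ₚ []

  record IsBasicSeq (P : Op) (s : ℕ → Pol) : Set (c ⊔ ℓ) where
    field
      degree : ∀ n → HasDeg (s n) n
      s₀     : s 0 ≈ₚ mono 0
      at0    : ∀ n → coeff (s (suc n)) 0 ≈ 0#
      Ps     : ∀ n → P (s (suc n)) ≈ₚ scale (natK (suc n)) (s n)

-- Write Q = P − D and U_N = Σ_{k<N} Xᵏ Qᵏ / k!. Shift invariance makes P commute with D:
-- the Taylor expansions of P(p(x + a)) and (P p)(x + a), as polynomials in a, agree at every
-- a ∈ ℕ and hence coincide. So P commutes with Q, and the Leibniz rule
-- D Xᵏ⁺¹ = Xᵏ⁺¹ D + (k+1) Xᵏ gives D (U_N p) = Σ_{k<N} Xᵏ (D + Q) Qᵏ p / k! = U_N (P p)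
-- whenever deg p < N, since then Q^N p = 0 (Q lowers degrees). As U_N p and p share their
-- constant term and D determines a polynomial up to that term (characteristic zero),
-- induction on n with P sₙ = n sₙ₋₁ and D xⁿ = n xⁿ⁻¹ gives U_N sₙ = xⁿ for n < N; since
-- deg sₙ = n, the linear maps U and U_N then agree on every polynomial of degree < N.

module Submission where

open import Defs
open import Level using (Level; _⊔_)
open import Data.Nat using (ℕ; zero; suc; _≤_; _<_; z≤n; s≤s) renaming (_+_ to _+ℕ_)
import Data.Nat.Properties as ℕ
open import Data.List using ([]; _∷_; length; applyUpTo)
open import Data.Product using (Σ-syntax; _×_; _,_; proj₂)
open import Data.Sum using (inj₁; inj₂)
open import Function using (_∘_; case_of_)
open import Relation.Binary.Bundles using (Setoid)
open import Relation.Binary.Structures using (IsEquivalence)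
open import Relation.Binary.PropositionalEquality as ≡ using (_≡_)
open import Relation.Nullary using (¬_)
open import Algebra.Bundles using (CommutativeMonoid; Ring)
open import Algebra.Structures using (IsCommutativeMonoid)
import Relation.Binary.Reasoning.Setoid as SetoidReasoning

module Polynomials {c ℓ : Level} (F : Field c ℓ) where
  open Field F hiding (zero)
  open Poly F
  open import Algebra.Properties.Group +-group using (ε⁻¹≈ε)
  open import Algebra.Properties.Ring ring using (-1*x≈-x)
  open import Algebra.Properties.RingWithoutOne (Ring.ringWithoutOne ring) using (-‿distribʳ-*)
  open import Algebra.Properties.AbelianGroup +-abelianGroup using (⁻¹-∙-comm)
  open import Algebra.Properties.CommutativeSemigroup *-commutativeSemigroup using (x∙yz≈y∙xz)
  open import Algebra.Solver.Ring.NaturalCoefficients.Default commutativeSemiring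
    using (solve; _:+_; _:*_; _:=_; con)
  module ≈-Reasoning = SetoidReasoning setoid

  -- ≈ₚ wrapped in a record, so that the compared polynomials can be inferred.
  infix 4 _≋_
  record _≋_ (p q : Pol) : Set ℓ where
    constructor coeffwise
    field at : ∀ n → coeff p n ≈ coeff q n
  open _≋_ public

  ≋-isEquivalence : IsEquivalence _≋_
  ≋-isEquivalence = record
    { refl  = coeffwise λ n → refl
    ; sym   = λ e → coeffwise λ n → sym (at e n)
    ; trans = λ e f → coeffwise λ n → trans (at e n) (at f n)
    }

  open IsEquivalence ≋-isEquivalence public
    using () renaming (refl to ≋-refl; sym to ≋-sym; trans to ≋-trans)

  ≋-setoid : Setoid c ℓ
  ≋-setoid = record { isEquivalence = ≋-isEquivalence }

  module ≋-Reasoning = SetoidReasoning ≋-setoid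

  coeff-+ₚ : ∀ p q n → coeff (p +ₚ q) n ≈ coeff p n + coeff q n
  coeff-+ₚ []       q        n       = sym (+-identityˡ _)
  coeff-+ₚ (a ∷ as) []       n       = sym (+-identityʳ _)
  coeff-+ₚ (a ∷ as) (b ∷ bs) zero    = refl
  coeff-+ₚ (a ∷ as) (b ∷ bs) (suc n) = coeff-+ₚ as bs n

  coeff-scale : ∀ a p n → coeff (scale a p) n ≈ a * coeff p n
  coeff-scale a []       n       = sym (zeroʳ a)
  coeff-scale a (b ∷ bs) zero    = refl
  coeff-scale a (b ∷ bs) (suc n) = coeff-scale a bs n

  coeff-negₚ : ∀ p n → coeff (negₚ p) n ≈ - coeff p n
  coeff-negₚ []       n       = sym ε⁻¹≈ε
  coeff-negₚ (b ∷ bs) zero    = refl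
  coeff-negₚ (b ∷ bs) (suc n) = coeff-negₚ bs n

  coeff-deriv′ : ∀ k p n → coeff (deriv′ k p) n ≈ natK (k +ℕ n) * coeff p n
  coeff-deriv′ k []       n       = sym (zeroʳ _)
  coeff-deriv′ k (a ∷ as) zero    rewrite ℕ.+-identityʳ k = refl
  coeff-deriv′ k (a ∷ as) (suc n) rewrite ℕ.+-suc k n = coeff-deriv′ (suc k) as n

  coeff-D : ∀ p n → coeff (D p) n ≈ natK (suc n) * coeff p (suc n)
  coeff-D []       n = sym (zeroʳ _)
  coeff-D (a ∷ as) n = coeff-deriv′ 1 as n

  +ₚ-cong : ∀ {p p′ q q′} → p ≋ p′ → q ≋ q′ → p +ₚ q ≋ p′ +ₚ q′
  +ₚ-cong {p} {p′} {q} {q′} e f = coeffwise λ n → begin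
    coeff (p +ₚ q) n     ≈⟨ coeff-+ₚ p q n ⟩
    coeff p n + coeff q n   ≈⟨ +-cong (at e n) (at f n) ⟩
    coeff p′ n + coeff q′ n ≈⟨ coeff-+ₚ p′ q′ n ⟨
    coeff (p′ +ₚ q′) n   ∎
    where open ≈-Reasoning

  +ₚ-congˡ : ∀ p {q q′} → q ≋ q′ → p +ₚ q ≋ p +ₚ q′
  +ₚ-congˡ p = +ₚ-cong ≋-refl

  +ₚ-congʳ : ∀ {p p′} q → p ≋ p′ → p +ₚ q ≋ p′ +ₚ q
  +ₚ-congʳ q e = +ₚ-cong e ≋-refl

  scale-cong : ∀ {a b p q} → a ≈ b → p ≋ q → scale a p ≋ scale b q
  scale-cong {a} {b} {p} {q} e f = coeffwise λ n →
    trans (coeff-scale a p n) (trans (*-cong e (at f n)) (sym (coeff-scale b q n)))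

  scale-congˡ : ∀ {a p q} → p ≋ q → scale a p ≋ scale a q
  scale-congˡ = scale-cong refl

  scale-congʳ : ∀ {a b} p → a ≈ b → scale a p ≋ scale b p
  scale-congʳ p e = scale-cong e (≋-refl {p})

  negₚ-cong : ∀ {p q} → p ≋ q → negₚ p ≋ negₚ q
  negₚ-cong {p} {q} e = coeffwise λ n →
    trans (coeff-negₚ p n) (trans (-‿cong (at e n)) (sym (coeff-negₚ q n)))

  X-cong : ∀ {p q} → p ≋ q → X p ≋ X q
  X-cong e = coeffwise λ { zero → refl ; (suc n) → at e n }

  D-cong : ∀ {p q} → p ≋ q → D p ≋ D q
  D-cong {p} {q} e = coeffwise λ n →
    trans (coeff-D p n) (trans (*-congˡ (at e (suc n))) (sym (coeff-D q n)))

  +ₚ-isCommutativeMonoid : IsCommutativeMonoid _≋_ _+ₚ_ []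
  +ₚ-isCommutativeMonoid = record
    { isMonoid = record
      { isSemigroup = record
        { isMagma = record { isEquivalence = ≋-isEquivalence ; ∙-cong = +ₚ-cong }
        ; assoc   = λ p q r → coeffwise λ n → begin
            coeff ((p +ₚ q) +ₚ r) n
              ≈⟨ trans (coeff-+ₚ (p +ₚ q) r n) (+-congʳ (coeff-+ₚ p q n)) ⟩
            (coeff p n + coeff q n) + coeff r n
              ≈⟨ +-assoc _ _ _ ⟩
            coeff p n + (coeff q n + coeff r n)
              ≈⟨ trans (coeff-+ₚ p (q +ₚ r) n) (+-congˡ (coeff-+ₚ q r n)) ⟨
            coeff (p +ₚ (q +ₚ r)) n
              ∎
        }
      ; identity = (λ p → ≋-refl) , (λ p → coeffwise λ n → trans (coeff-+ₚ p [] n) (+-identityʳ _))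
      }
    ; comm = λ p q → coeffwise λ n →
        trans (coeff-+ₚ p q n) (trans (+-comm _ _) (sym (coeff-+ₚ q p n)))
    }
    where open ≈-Reasoning

  +ₚ-commutativeMonoid : CommutativeMonoid c ℓ
  +ₚ-commutativeMonoid = record { isCommutativeMonoid = +ₚ-isCommutativeMonoid }

  open IsCommutativeMonoid +ₚ-isCommutativeMonoid public
    using () renaming (assoc to +ₚ-assoc; comm to +ₚ-comm; identityʳ to +ₚ-identityʳ)
  open import Algebra.Properties.CommutativeSemigroup
    (CommutativeMonoid.commutativeSemigroup +ₚ-commutativeMonoid) public
    using () renaming (interchange to +ₚ-interchange; x∙yz≈y∙xz to +ₚ-leftComm)

  +ₚ-inverseʳ : ∀ p → p +ₚ negₚ p ≋ []
  +ₚ-inverseʳ p = coeffwise λ n →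
    trans (coeff-+ₚ p (negₚ p) n) (trans (+-congˡ (coeff-negₚ p n)) (-‿inverseʳ _))

  scale-distrib-+ₚ : ∀ a p q → scale a (p +ₚ q) ≋ scale a p +ₚ scale a q
  scale-distrib-+ₚ a p q = coeffwise λ n → begin
    coeff (scale a (p +ₚ q)) n              ≈⟨ trans (coeff-scale a (p +ₚ q) n) (*-congˡ (coeff-+ₚ p q n)) ⟩
    a * (coeff p n + coeff q n)             ≈⟨ distribˡ _ _ _ ⟩
    a * coeff p n + a * coeff q n
      ≈⟨ trans (coeff-+ₚ (scale a p) (scale a q) n) (+-cong (coeff-scale a p n) (coeff-scale a q n)) ⟨
    coeff (scale a p +ₚ scale a q) n        ∎
    where open ≈-Reasoning

  scale-assoc : ∀ a b p → scale a (scale b p) ≋ scale (a * b) p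
  scale-assoc a b p = coeffwise λ n →
    trans (coeff-scale a (scale b p) n) (trans (*-congˡ (coeff-scale b p n))
      (trans (sym (*-assoc _ _ _)) (sym (coeff-scale (a * b) p n))))

  scale-comm : ∀ a b p → scale a (scale b p) ≋ scale b (scale a p)
  scale-comm a b p =
    ≋-trans (scale-assoc a b p) (≋-trans (scale-cong (*-comm a b) ≋-refl) (≋-sym (scale-assoc b a p)))

  negₚ≋scale-1 : ∀ p → negₚ p ≋ scale (- 1#) p
  negₚ≋scale-1 p = coeffwise λ n →
    trans (coeff-negₚ p n) (trans (sym (-1*x≈-x _)) (sym (coeff-scale (- 1#) p n)))

  scale-0# : ∀ p → scale 0# p ≋ []
  scale-0# p = coeffwise λ n → trans (coeff-scale 0# p n) (zeroˡ _)

  scale-natK-suc : ∀ k p → scale (natK (suc k)) p ≋ p +ₚ scale (natK k) p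
  scale-natK-suc k p = coeffwise λ n → begin
    coeff (scale (1# + natK k) p) n          ≈⟨ coeff-scale (1# + natK k) p n ⟩
    (1# + natK k) * coeff p n                ≈⟨ trans (distribʳ _ _ _) (+-congʳ (*-identityˡ _)) ⟩
    coeff p n + natK k * coeff p n           ≈⟨ trans (coeff-+ₚ p _ n) (+-congˡ (coeff-scale (natK k) p n)) ⟨
    coeff (p +ₚ scale (natK k) p) n          ∎
    where open ≈-Reasoning

  scale-natK-1 : ∀ p → scale (natK 1) p ≋ p
  scale-natK-1 p = ≋-trans (scale-natK-suc 0 p) (≋-trans (+ₚ-congˡ p (scale-0# p)) (+ₚ-identityʳ p))

  -- Linear operators

  record Linear (T : Op) : Set (c ⊔ ℓ) where
    field
      ≋-cong      : ∀ {p q} → p ≋ q → T p ≋ T q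
      additive    : ∀ p q → T (p +ₚ q) ≋ T p +ₚ T q
      homogeneous : ∀ a p → T (scale a p) ≋ scale a (T p)

  isLinear⇒Linear : ∀ {T} → IsLinear T → Linear T
  isLinear⇒Linear l = record
    { ≋-cong      = λ {p} {q} e → coeffwise (IsLinear.cong-≈ₚ l p q (at e))
    ; additive    = λ p q → coeffwise (IsLinear.additive l p q)
    ; homogeneous = λ a p → coeffwise (IsLinear.homog l a p)
    }

  module _ {T : Op} (L : Linear T) where
    open Linear L

    linear-[] : T [] ≋ []
    linear-[] = coeffwise λ n →
      trans (at (homogeneous 0# []) n) (trans (coeff-scale 0# (T []) n) (zeroˡ _))

    linear-≋[] : ∀ {p} → p ≋ [] → T p ≋ []
    linear-≋[] e = ≋-trans (≋-cong e) linear-[]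

    linear-negₚ : ∀ p → T (negₚ p) ≋ negₚ (T p)
    linear-negₚ p = begin
      T (negₚ p)          ≈⟨ ≋-cong (negₚ≋scale-1 p) ⟩
      T (scale (- 1#) p)  ≈⟨ homogeneous (- 1#) p ⟩
      scale (- 1#) (T p)  ≈⟨ negₚ≋scale-1 (T p) ⟨
      negₚ (T p)          ∎
      where open ≋-Reasoning

  id-linear : Linear (λ p → p)
  id-linear = record { ≋-cong = λ e → e ; additive = λ p q → ≋-refl ; homogeneous = λ a p → ≋-refl }

  ∘-linear : ∀ {S T} → Linear S → Linear T → Linear (S ∘ T)
  ∘-linear LS LT = record
    { ≋-cong      = λ e → S.≋-cong (T.≋-cong e)
    ; additive    = λ p q → ≋-trans (S.≋-cong (T.additive p q)) (S.additive _ _)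
    ; homogeneous = λ a p → ≋-trans (S.≋-cong (T.homogeneous a p)) (S.homogeneous _ _)
    }
    where module S = Linear LS
          module T = Linear LT

  iter-linear : ∀ {T} → Linear T → ∀ k → Linear (iter T k)
  iter-linear L zero    = id-linear
  iter-linear L (suc k) = ∘-linear L (iter-linear L k)

  pointwise-+ₚ-linear : ∀ {S T} → Linear S → Linear T → Linear (λ p → S p +ₚ T p)
  pointwise-+ₚ-linear {S} {T} LS LT = record
    { ≋-cong      = λ e → +ₚ-cong (LS′.≋-cong e) (LT′.≋-cong e)
    ; additive    = λ p q → ≋-trans (+ₚ-cong (LS′.additive p q) (LT′.additive p q))
                                     (+ₚ-interchange (S p) (S q) (T p) (T q))
    ; homogeneous = λ a p → ≋-trans (+ₚ-cong (LS′.homogeneous a p) (LT′.homogeneous a p))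
                                     (≋-sym (scale-distrib-+ₚ a (S p) (T p)))
    }
    where module LS′ = Linear LS
          module LT′ = Linear LT

  scale-linear : ∀ b → Linear (scale b)
  scale-linear b = record
    { ≋-cong = scale-congˡ ; additive = scale-distrib-+ₚ b ; homogeneous = λ a p → scale-comm b a p }

  negₚ-linear : Linear negₚ
  negₚ-linear = record
    { ≋-cong      = negₚ-cong
    ; additive    = λ p q → ≋-trans (negₚ≋scale-1 (p +ₚ q))
        (≋-trans (scale-distrib-+ₚ (- 1#) p q) (≋-sym (+ₚ-cong (negₚ≋scale-1 p) (negₚ≋scale-1 q))))
    ; homogeneous = λ a p → ≋-sym (linear-negₚ (scale-linear a) p)
    }

  −ₒ-linear : ∀ {S T} → Linear S → Linear T → Linear (S −ₒ T)
  −ₒ-linear LS LT = pointwise-+ₚ-linear LS (∘-linear negₚ-linear LT)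

  X-linear : Linear X
  X-linear = record
    { ≋-cong      = X-cong
    ; additive    = λ p q → coeffwise λ { zero → sym (+-identityʳ 0#) ; (suc n) → refl }
    ; homogeneous = λ a p → coeffwise λ { zero → sym (zeroʳ a) ; (suc n) → refl }
    }

  D-linear : Linear D
  D-linear = record
    { ≋-cong      = D-cong
    ; additive    = λ p q → coeffwise λ n → begin
        coeff (D (p +ₚ q)) n
          ≈⟨ trans (coeff-D (p +ₚ q) n) (*-congˡ (coeff-+ₚ p q (suc n))) ⟩
        k n * (coeff p (suc n) + coeff q (suc n))
          ≈⟨ distribˡ _ _ _ ⟩
        k n * coeff p (suc n) + k n * coeff q (suc n)
          ≈⟨ trans (coeff-+ₚ (D p) (D q) n) (+-cong (coeff-D p n) (coeff-D q n)) ⟨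
        coeff (D p +ₚ D q) n                       ∎
    ; homogeneous = λ a p → coeffwise λ n → begin
        coeff (D (scale a p)) n         ≈⟨ trans (coeff-D (scale a p) n) (*-congˡ (coeff-scale a p (suc n))) ⟩
        k n * (a * coeff p (suc n))     ≈⟨ x∙yz≈y∙xz (k n) a _ ⟩
        a * (k n * coeff p (suc n))     ≈⟨ trans (coeff-scale a (D p) n) (*-congˡ (coeff-D p n)) ⟨
        coeff (scale a (D p)) n         ∎
    }
    where open ≈-Reasoning
          k : ℕ → Carrier
          k n = natK (suc n)

  sumₚ-cong : ∀ N {f g : ℕ → Pol} → (∀ k → k < N → f k ≋ g k) → sumₚ N f ≋ sumₚ N g
  sumₚ-cong zero    e = ≋-refl
  sumₚ-cong (suc N) e = +ₚ-cong (sumₚ-cong N λ k k<N → e k (ℕ.m<n⇒m<1+n k<N)) (e N ℕ.≤-refl)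

  sumₚ-+ₚ : ∀ N (f g : ℕ → Pol) → sumₚ N (λ k → f k +ₚ g k) ≋ sumₚ N f +ₚ sumₚ N g
  sumₚ-+ₚ zero    f g = ≋-refl
  sumₚ-+ₚ (suc N) f g =
    ≋-trans (+ₚ-congʳ (f N +ₚ g N) (sumₚ-+ₚ N f g)) (+ₚ-interchange (sumₚ N f) (sumₚ N g) (f N) (g N))

  sumₚ-linear : ∀ N (T : ℕ → Op) → (∀ k → Linear (T k)) → Linear (λ p → sumₚ N (λ k → T k p))
  sumₚ-linear zero    T L = record
    { ≋-cong = λ e → ≋-refl ; additive = λ p q → ≋-refl ; homogeneous = λ a p → ≋-refl }
  sumₚ-linear (suc N) T L = pointwise-+ₚ-linear (sumₚ-linear N T L) (L N)

  infix 4 _CommutesWith_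
  _CommutesWith_ : Op → Op → Set (c ⊔ ℓ)
  S CommutesWith T = ∀ p → S (T p) ≋ T (S p)

  commutesWith-−ₒ : ∀ {T S R} → Linear T → T CommutesWith S → T CommutesWith R → T CommutesWith (S −ₒ R)
  commutesWith-−ₒ {T} {S} {R} LT TS TR p = begin
    T (S p +ₚ negₚ (R p))       ≈⟨ additive (S p) (negₚ (R p)) ⟩
    T (S p) +ₚ T (negₚ (R p))   ≈⟨ +ₚ-cong (TS p) (≋-trans (linear-negₚ LT (R p)) (negₚ-cong (TR p))) ⟩
    S (T p) +ₚ negₚ (R (T p))   ∎
    where open ≋-Reasoning
          open Linear LT

  commutesWith-iter : ∀ {T S} → Linear S → T CommutesWith S → ∀ k → T CommutesWith iter S k
  commutesWith-iter LS TS zero    p = ≋-refl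
  commutesWith-iter LS TS (suc k) p =
    ≋-trans (TS _) (Linear.≋-cong LS (commutesWith-iter LS TS k p))

  -- Degree bounds

  record DegreeBelow (m : ℕ) (p : Pol) : Set ℓ where
    constructor degreeBelow
    field vanishes : ∀ n → m ≤ n → coeff p n ≈ 0#
  open DegreeBelow public

  hasDeg⇒degreeBelow : ∀ {p n} → HasDeg p n → DegreeBelow (suc n) p
  hasDeg⇒degreeBelow h = degreeBelow (proj₂ h)

  degreeBelow-length : ∀ p → DegreeBelow (length p) p
  degreeBelow-length p = degreeBelow (vanish p)
    where
    vanish : ∀ p n → length p ≤ n → coeff p n ≈ 0#
    vanish []       n       _       = refl
    vanish (b ∷ bs) (suc n) (s≤s l) = vanish bs n l

  degreeBelow-weaken : ∀ {m m′ p} → m ≤ m′ → DegreeBelow m p → DegreeBelow m′ p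
  degreeBelow-weaken m≤m′ d = degreeBelow λ n l → vanishes d n (ℕ.≤-trans m≤m′ l)

  degreeBelow-zero : ∀ {p} → DegreeBelow 0 p → p ≋ []
  degreeBelow-zero d = coeffwise λ n → vanishes d n z≤n

  ≋[]⇒degreeBelow : ∀ {m p} → p ≋ [] → DegreeBelow m p
  ≋[]⇒degreeBelow e = degreeBelow λ n _ → at e n

  degreeBelow-cong : ∀ {m p q} → p ≋ q → DegreeBelow m p → DegreeBelow m q
  degreeBelow-cong e d = degreeBelow λ n l → trans (sym (at e n)) (vanishes d n l)

  degreeBelow-+ₚ : ∀ {m p q} → DegreeBelow m p → DegreeBelow m q → DegreeBelow m (p +ₚ q)
  degreeBelow-+ₚ {p = p} {q} dp dq = degreeBelow λ n l →
    trans (coeff-+ₚ p q n) (trans (+-cong (vanishes dp n l) (vanishes dq n l)) (+-identityʳ 0#))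

  degreeBelow-scale : ∀ {m p} a → DegreeBelow m p → DegreeBelow m (scale a p)
  degreeBelow-scale {p = p} a d = degreeBelow λ n l →
    trans (coeff-scale a p n) (trans (*-congˡ (vanishes d n l)) (zeroʳ a))

  degreeBelow-negₚ : ∀ {m p} → DegreeBelow m p → DegreeBelow m (negₚ p)
  degreeBelow-negₚ {p = p} d = degreeBelow λ n l →
    trans (coeff-negₚ p n) (trans (-‿cong (vanishes d n l)) ε⁻¹≈ε)

  degreeBelow-D : ∀ {m p} → DegreeBelow (suc m) p → DegreeBelow m (D p)
  degreeBelow-D {p = p} d = degreeBelow λ n l →
    trans (coeff-D p n) (trans (*-congˡ (vanishes d (suc n) (s≤s l))) (zeroʳ _))

  mono-hasDeg : ∀ m → HasDeg (mono m) m
  mono-hasDeg m = leading m , vanish m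
    where
    leading : ∀ m → ¬ (coeff (mono m) m ≈ 0#)
    leading zero    e = 0≉1 (sym e)
    leading (suc m) e = leading m e
    vanish : ∀ m n → m < n → coeff (mono m) n ≈ 0#
    vanish zero    (suc n) _       = refl
    vanish (suc m) (suc n) (s≤s l) = vanish m n l

  splitByLeadingTerm : ∀ {m p v} → HasDeg v m → DegreeBelow (suc m) p →
                       Σ[ e ∈ Carrier ] Σ[ r ∈ Pol ] (p ≋ scale e v +ₚ r × DegreeBelow m r)
  splitByLeadingTerm {m} {p} {v} (v≉0 , v-top) dp = e , r , split , r-top
    where
    e : Carrier
    e = coeff p m * inv (coeff v m) v≉0
    r : Pol
    r = p +ₚ negₚ (scale e v)

    split : p ≋ scale e v +ₚ r
    split = ≋-sym (begin
      scale e v +ₚ (p +ₚ negₚ (scale e v))   ≈⟨ +ₚ-leftComm (scale e v) p (negₚ (scale e v)) ⟩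
      p +ₚ (scale e v +ₚ negₚ (scale e v))   ≈⟨ +ₚ-congˡ p (+ₚ-inverseʳ (scale e v)) ⟩
      p +ₚ []                                ≈⟨ +ₚ-identityʳ p ⟩
      p                                      ∎)
      where open ≋-Reasoning

    e*v≈p : coeff (scale e v) m ≈ coeff p m
    e*v≈p = trans (coeff-scale e v m) (trans (*-assoc _ _ _)
      (trans (*-congˡ (trans (*-comm _ _) (inverse _ v≉0))) (*-identityʳ _)))

    r-top : DegreeBelow m r
    r-top = degreeBelow λ n m≤n → case ℕ.m≤n⇒m<n∨m≡n m≤n of λ where
        (inj₁ m<n)    → vanishes (degreeBelow-+ₚ dp (degreeBelow-negₚ (degreeBelow-scale e
                          (hasDeg⇒degreeBelow (v≉0 , v-top))))) n m<n
        (inj₂ ≡.refl) → begin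
          coeff r m                            ≈⟨ coeff-+ₚ p (negₚ (scale e v)) m ⟩
          coeff p m + coeff (negₚ (scale e v)) m ≈⟨ +-congˡ (coeff-negₚ (scale e v) m) ⟩
          coeff p m + - coeff (scale e v) m    ≈⟨ +-congˡ (-‿cong e*v≈p) ⟩
          coeff p m + - coeff p m              ≈⟨ -‿inverseʳ _ ⟩
          0#                                   ∎
      where open ≈-Reasoning

  linear-split : ∀ {T p e v r} → Linear T → p ≋ scale e v +ₚ r → T p ≋ scale e (T v) +ₚ T r
  linear-split {T} {e = e} {v} {r} L split =
    ≋-trans (T.≋-cong split) (≋-trans (T.additive (scale e v) r) (+ₚ-congʳ (T r) (T.homogeneous e v)))
    where module T = Linear L

  linear-agree : ∀ {S T} → Linear S → Linear T → (v : ℕ → Pol) → (∀ n → HasDeg (v n) n) →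
                 ∀ m → (∀ n → n < m → S (v n) ≋ T (v n)) → ∀ {p} → DegreeBelow m p → S p ≋ T p
  linear-agree LS LT v deg zero    agree dp =
    ≋-trans (linear-≋[] LS (degreeBelow-zero dp)) (≋-sym (linear-≋[] LT (degreeBelow-zero dp)))
  linear-agree {S} {T} LS LT v deg (suc m) agree {p} dp
    with splitByLeadingTerm (deg m) dp
  ... | e , r , split , dr = begin
    S p                           ≈⟨ linear-split LS split ⟩
    scale e (S (v m)) +ₚ S r      ≈⟨ +ₚ-cong (scale-congˡ (agree m ℕ.≤-refl))
                                          (linear-agree LS LT v deg m (λ n n<m → agree n (ℕ.m<n⇒m<1+n n<m)) dr) ⟩
    scale e (T (v m)) +ₚ T r      ≈⟨ linear-split LT split ⟨
    T p                           ∎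
    where open ≋-Reasoning

  linear-lowersDegree : ∀ {T} → Linear T → (v : ℕ → Pol) → (∀ n → HasDeg (v n) n) →
                        (∀ n → DegreeBelow n (T (v n))) →
                        ∀ m {p} → DegreeBelow (suc m) p → DegreeBelow m (T p)
  linear-lowersDegree {T} L v deg lowers m dp with splitByLeadingTerm (deg m) dp
  ... | e , r , split , dr =
    degreeBelow-cong (≋-sym (linear-split L split))
      (degreeBelow-+ₚ (degreeBelow-scale e (lowers m)) (remainder m dr))
    where
    remainder : ∀ m {r} → DegreeBelow m r → DegreeBelow m (T r)
    remainder zero    dr = ≋[]⇒degreeBelow (linear-≋[] L (degreeBelow-zero dr))
    remainder (suc m) dr = degreeBelow-weaken (ℕ.n≤1+n m) (linear-lowersDegree L v deg lowers m dr)

  D-X : ∀ r → D (X r) ≋ r +ₚ X (D r)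
  D-X r = coeffwise λ where
      zero    → trans (coeff-deriv′ 1 r 0) (trans (*-congʳ (+-identityʳ 1#))
                  (trans (*-identityˡ _) (sym (trans (coeff-+ₚ r (X (D r)) 0) (+-identityʳ _)))))
      (suc n) → begin
        coeff (D (X r)) (suc n)                       ≈⟨ coeff-deriv′ 1 r (suc n) ⟩
        (1# + natK (suc n)) * coeff r (suc n)          ≈⟨ trans (distribʳ _ _ _) (+-congʳ (*-identityˡ _)) ⟩
        coeff r (suc n) + natK (suc n) * coeff r (suc n)
          ≈⟨ trans (coeff-+ₚ r (X (D r)) (suc n)) (+-congˡ (coeff-D r n)) ⟨
        coeff (r +ₚ X (D r)) (suc n)                  ∎
    where open ≈-Reasoning

  D-iterX : ∀ k r → D (iter X (suc k) r) ≋ iter X (suc k) (D r) +ₚ scale (natK (suc k)) (iter X k r)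
  D-iterX zero r = begin
    D (X r)                       ≈⟨ D-X r ⟩
    r +ₚ X (D r)                  ≈⟨ +ₚ-comm r (X (D r)) ⟩
    X (D r) +ₚ r                  ≈⟨ +ₚ-congˡ (X (D r)) (scale-natK-1 r) ⟨
    X (D r) +ₚ scale (natK 1) r   ∎
    where open ≋-Reasoning
  D-iterX (suc k) r = begin
    D (X A)                                             ≈⟨ D-X A ⟩
    A +ₚ X (D A)                                        ≈⟨ +ₚ-congˡ A (X-cong (D-iterX k r)) ⟩
    A +ₚ X (X^k+1 (D r) +ₚ scale t (iter X k r))
      ≈⟨ +ₚ-congˡ A (≋-trans (X.additive (X^k+1 (D r)) (scale t (iter X k r)))
                             (+ₚ-congˡ B (X.homogeneous t (iter X k r)))) ⟩
    A +ₚ (B +ₚ scale t A)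
      ≈⟨ +ₚ-leftComm A B (scale t A) ⟩
    B +ₚ (A +ₚ scale t A)                 ≈⟨ +ₚ-congˡ B (scale-natK-suc (suc k) A) ⟨
    B +ₚ scale (natK (suc (suc k))) A     ∎
    where open ≋-Reasoning
          module X = Linear X-linear
          X^k+1 : Op
          X^k+1 = iter X (suc k)
          A B : Pol
          A = X^k+1 r
          B = X (X^k+1 (D r))
          t : Carrier
          t = natK (suc k)

  deriv′-mono : ∀ k m → deriv′ k (mono m) ≋ scale (natK (k +ℕ m)) (mono m)
  deriv′-mono k zero    rewrite ℕ.+-identityʳ k = ≋-refl
  deriv′-mono k (suc m) = coeffwise λ where
    zero    → trans (zeroʳ _) (sym (zeroʳ _))
    (suc n) → ≡.subst (λ j → coeff (deriv′ (suc k) (mono m)) n ≈ coeff (scale (natK j) (mono m)) n)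
                (≡.sym (ℕ.+-suc k m)) (at (deriv′-mono (suc k) m) n)

  D-mono : ∀ m → D (mono (suc m)) ≋ scale (natK (suc m)) (mono m)
  D-mono = deriv′-mono 1

  -- Evaluation and synthetic division

  eval : Pol → Carrier → Carrier
  eval []       a = 0#
  eval (b ∷ bs) a = b + a * eval bs a

  eval-+ₚ : ∀ p q a → eval (p +ₚ q) a ≈ eval p a + eval q a
  eval-+ₚ []       q        a = sym (+-identityˡ _)
  eval-+ₚ (b ∷ bs) []       a = sym (+-identityʳ _)
  eval-+ₚ (b ∷ bs) (d ∷ ds) a = begin
    (b + d) + a * eval (bs +ₚ ds) a                 ≈⟨ +-congˡ (*-congˡ (eval-+ₚ bs ds a)) ⟩
    (b + d) + a * (eval bs a + eval ds a)           ≈⟨ solve 5 (λ b d a x y → (b :+ d) :+ a :* (x :+ y)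
                                                         := (b :+ a :* x) :+ (d :+ a :* y)) refl b d a _ _ ⟩
    (b + a * eval bs a) + (d + a * eval ds a)       ∎
    where open ≈-Reasoning

  eval-negₚ : ∀ p a → eval (negₚ p) a ≈ - eval p a
  eval-negₚ []       a = sym ε⁻¹≈ε
  eval-negₚ (b ∷ bs) a = begin
    - b + a * eval (negₚ bs) a  ≈⟨ +-congˡ (trans (*-congˡ (eval-negₚ bs a)) (sym (-‿distribʳ-* a _))) ⟩
    - b + - (a * eval bs a)     ≈⟨ ⁻¹-∙-comm b _ ⟩
    - (b + a * eval bs a)       ∎
    where open ≈-Reasoning

  -- Synthetic division: (b ∷ bs)(x) − (b ∷ bs)(c) = (x − c) · (quotientBy c bs)(x).
  quotientBy : Carrier → Pol → Pol
  quotientBy c []       = []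
  quotientBy c (b ∷ bs) = eval (b ∷ bs) c ∷ quotientBy c bs

  length-quotientBy : ∀ c bs → length (quotientBy c bs) ≡ length bs
  length-quotientBy c []       = ≡.refl
  length-quotientBy c (b ∷ bs) = ≡.cong suc (length-quotientBy c bs)

  eval-quotientBy : ∀ c a b bs → eval (b ∷ bs) a + c * eval (quotientBy c bs) a
                                 ≈ a * eval (quotientBy c bs) a + eval (b ∷ bs) c
  eval-quotientBy c a b [] =
    solve 3 (λ a b c → (b :+ a :* con 0) :+ c :* con 0 := a :* con 0 :+ (b :+ c :* con 0)) refl a b c
  eval-quotientBy c a b (b′ ∷ bs) = begin
    (b + a * pa) + c * (pc + a * q)   ≈⟨ solve 6 (λ a b c pa pc q → (b :+ a :* pa) :+ c :* (pc :+ a :* q)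
                                           := (b :+ c :* pc) :+ a :* (pa :+ c :* q)) refl a b c pa pc q ⟩
    (b + c * pc) + a * (pa + c * q)   ≈⟨ +-congˡ (*-congˡ (eval-quotientBy c a b′ bs)) ⟩
    (b + c * pc) + a * (a * q + pc)   ≈⟨ solve 5 (λ a b c pc q → (b :+ c :* pc) :+ a :* (a :* q :+ pc)
                                           := a :* (pc :+ a :* q) :+ (b :+ c :* pc)) refl a b c pc q ⟩
    a * (pc + a * q) + (b + c * pc)   ∎
    where open ≈-Reasoning
          pa pc q : Carrier
          pa = eval (b′ ∷ bs) a
          pc = eval (b′ ∷ bs) c
          q  = eval (quotientBy c bs) a

  x≈0⇒b+c*x≈b : ∀ b c {x} → x ≈ 0# → b + c * x ≈ b
  x≈0⇒b+c*x≈b b c x≈0 = trans (+-congˡ (trans (*-congˡ x≈0) (zeroʳ c))) (+-identityʳ b)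

  quotientBy-≋[] : ∀ c b bs → quotientBy c bs ≋ [] → eval (b ∷ bs) c ≈ 0# → b ∷ bs ≋ []
  quotientBy-≋[] c b []        _    root = coeffwise λ where
    zero    → trans (sym (x≈0⇒b+c*x≈b b c refl)) root
    (suc n) → refl
  quotientBy-≋[] c b (b′ ∷ bs) q≋[] root = coeffwise λ where
    zero    → trans (sym (x≈0⇒b+c*x≈b b c (at q≋[] 0))) root
    (suc n) → at (quotientBy-≋[] c b′ bs (coeffwise (at q≋[] ∘ suc)) (at q≋[] 0)) n

  -- Taylor expansion of the shift

  coeff-applyUpTo : ∀ (e : ℕ → Carrier) M m → m < M → coeff (applyUpTo e M) m ≡ e m
  coeff-applyUpTo e (suc M) zero    _       = ≡.refl
  coeff-applyUpTo e (suc M) (suc m) (s≤s l) = coeff-applyUpTo (e ∘ suc) M m l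

  hornerₚ : ℕ → (ℕ → Pol) → Carrier → Pol
  hornerₚ zero    g a = []
  hornerₚ (suc M) g a = g 0 +ₚ scale a (hornerₚ M (g ∘ suc) a)

  coeff-hornerₚ : ∀ M g a n → coeff (hornerₚ M g a) n ≈ eval (applyUpTo (λ m → coeff (g m) n) M) a
  coeff-hornerₚ zero    g a n = refl
  coeff-hornerₚ (suc M) g a n = trans (coeff-+ₚ (g 0) (scale a (hornerₚ M (g ∘ suc) a)) n)
    (+-congˡ (trans (coeff-scale a (hornerₚ M (g ∘ suc) a) n) (*-congˡ (coeff-hornerₚ M (g ∘ suc) a n))))

  hornerₚ-≋[] : ∀ M g a → (∀ m → g m ≋ []) → hornerₚ M g a ≋ []
  hornerₚ-≋[] zero    g a g≋[] = ≋-refl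
  hornerₚ-≋[] (suc M) g a g≋[] =
    +ₚ-cong (g≋[] 0) (scale-congˡ (hornerₚ-≋[] M (g ∘ suc) a (g≋[] ∘ suc)))

  hornerₚ-extend : ∀ M g a → g M ≋ [] → hornerₚ (suc M) g a ≋ hornerₚ M g a
  hornerₚ-extend zero    g a g≋[] = +ₚ-congʳ [] g≋[]
  hornerₚ-extend (suc M) g a g≋[] = +ₚ-congˡ (g 0) (scale-congˡ (hornerₚ-extend M (g ∘ suc) a g≋[]))

  hornerₚ-unfold : ∀ M g a → g M ≋ [] → hornerₚ M g a ≋ g 0 +ₚ scale a (hornerₚ M (g ∘ suc) a)
  hornerₚ-unfold M g a g≋[] = ≋-sym (hornerₚ-extend M g a g≋[])

  linear-hornerₚ : ∀ {L} → Linear L → ∀ M g a → L (hornerₚ M g a) ≋ hornerₚ M (L ∘ g) a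
  linear-hornerₚ lin zero    g a = linear-[] lin
  linear-hornerₚ {L} lin (suc M) g a = begin
    L (g 0 +ₚ scale a H)              ≈⟨ additive (g 0) (scale a H) ⟩
    L (g 0) +ₚ L (scale a H)          ≈⟨ +ₚ-congˡ (L (g 0)) (homogeneous a H) ⟩
    L (g 0) +ₚ scale a (L H)          ≈⟨ +ₚ-congˡ (L (g 0)) (scale-congˡ (linear-hornerₚ lin M (g ∘ suc) a)) ⟩
    L (g 0) +ₚ scale a (hornerₚ M (L ∘ g ∘ suc) a) ∎
    where open ≋-Reasoning
          open Linear lin
          H : Pol
          H = hornerₚ M (g ∘ suc) a

  hornerₚ-+ₚ : ∀ M g h a → hornerₚ M (λ m → g m +ₚ h m) a ≋ hornerₚ M g a +ₚ hornerₚ M h a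
  hornerₚ-+ₚ zero    g h a = ≋-refl
  hornerₚ-+ₚ (suc M) g h a = ≋-trans
    (+ₚ-congˡ (g 0 +ₚ h 0) (≋-trans (scale-congˡ (hornerₚ-+ₚ M (g ∘ suc) (h ∘ suc) a))
                                    (scale-distrib-+ₚ a (hornerₚ M (g ∘ suc) a) (hornerₚ M (h ∘ suc) a))))
    (+ₚ-interchange (g 0) (h 0) (scale a (hornerₚ M (g ∘ suc) a)) (scale a (hornerₚ M (h ∘ suc) a)))

  -- taylor m p = Dᵐ p / m!, computed without division from the Leibniz rule
  -- (b + x q)⁽ᵐ⁺¹⁾/(m+1)! = x q⁽ᵐ⁺¹⁾/(m+1)! + q⁽ᵐ⁾/m!.
  taylor : ℕ → Pol → Pol
  taylor zero    p        = p
  taylor (suc m) []       = []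
  taylor (suc m) (b ∷ bs) = X (taylor (suc m) bs) +ₚ taylor m bs

  taylor-vanish : ∀ m p → length p ≤ m → taylor m p ≋ []
  taylor-vanish zero    []       _       = ≋-refl
  taylor-vanish (suc m) []       _       = ≋-refl
  taylor-vanish (suc m) (b ∷ bs) (s≤s l) =
    +ₚ-cong (linear-≋[] X-linear (taylor-vanish (suc m) bs (ℕ.m≤n⇒m≤1+n l))) (taylor-vanish m bs l)

  taylor-1 : ∀ p → taylor 1 p ≋ D p
  taylor-1 []       = ≋-refl
  taylor-1 (b ∷ bs) = begin
    X (taylor 1 bs) +ₚ bs   ≈⟨ +ₚ-congʳ bs (X-cong (taylor-1 bs)) ⟩
    X (D bs) +ₚ bs          ≈⟨ +ₚ-comm (X (D bs)) bs ⟩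
    bs +ₚ X (D bs)          ≈⟨ D-X bs ⟨
    D (X bs)                ∎
    where open ≋-Reasoning

  cons≋[b]+ₚX : ∀ b bs → b ∷ bs ≋ (b ∷ []) +ₚ X bs
  cons≋[b]+ₚX b bs = coeffwise λ { zero → sym (+-identityʳ b) ; (suc n) → refl }

  shift≋taylorExpansion : ∀ a p M → length p ≤ M → shift a p ≋ hornerₚ M (λ m → taylor m p) a
  shift≋taylorExpansion a []       M       _       = ≋-sym (hornerₚ-≋[] M (λ m → taylor m []) a τ[]≋[])
    where τ[]≋[] : ∀ m → taylor m [] ≋ []
          τ[]≋[] zero    = ≋-refl
          τ[]≋[] (suc m) = ≋-refl
  shift≋taylorExpansion a (b ∷ bs) (suc M) (s≤s l) = begin
    [b] +ₚ (X (shift a bs) +ₚ scale a (shift a bs))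
      ≈⟨ +ₚ-congˡ [b] (+ₚ-cong (X-cong shift≋H) (scale-congˡ shift≋H)) ⟩
    [b] +ₚ (X H +ₚ scale a H)
      ≈⟨ +ₚ-congˡ [b] (+ₚ-congʳ (scale a H) XH≋Xbs+aXK) ⟩
    [b] +ₚ ((X bs +ₚ scale a (X K)) +ₚ scale a H)
      ≈⟨ +ₚ-congˡ [b] (+ₚ-assoc (X bs) (scale a (X K)) (scale a H)) ⟩
    [b] +ₚ (X bs +ₚ (scale a (X K) +ₚ scale a H))
      ≈⟨ +ₚ-assoc [b] (X bs) (scale a (X K) +ₚ scale a H) ⟨
    ([b] +ₚ X bs) +ₚ (scale a (X K) +ₚ scale a H)
      ≈⟨ +ₚ-cong (cons≋[b]+ₚX b bs) (scale-distrib-+ₚ a (X K) H) ⟨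
    (b ∷ bs) +ₚ scale a (X K +ₚ H)
      ≈⟨ +ₚ-congˡ (b ∷ bs) (scale-congˡ tail≋XK+H) ⟨
    (b ∷ bs) +ₚ scale a (hornerₚ M (λ m → X (taylor (suc m) bs) +ₚ taylor m bs) a)
      ∎
    where
    open ≋-Reasoning
    [b] K H : Pol
    [b] = b ∷ []
    K   = hornerₚ M (λ m → taylor (suc m) bs) a
    H   = hornerₚ M (λ m → taylor m bs) a
    shift≋H : shift a bs ≋ H
    shift≋H = shift≋taylorExpansion a bs M l
    XH≋Xbs+aXK : X H ≋ X bs +ₚ scale a (X K)
    XH≋Xbs+aXK = begin
      X H                       ≈⟨ X-cong (hornerₚ-unfold M (λ m → taylor m bs) a (taylor-vanish M bs l)) ⟩
      X (bs +ₚ scale a K)       ≈⟨ Linear.additive X-linear bs (scale a K) ⟩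
      X bs +ₚ X (scale a K)     ≈⟨ +ₚ-congˡ (X bs) (Linear.homogeneous X-linear a K) ⟩
      X bs +ₚ scale a (X K)     ∎
    tail≋XK+H : hornerₚ M (λ m → X (taylor (suc m) bs) +ₚ taylor m bs) a ≋ X K +ₚ H
    tail≋XK+H = ≋-trans (hornerₚ-+ₚ M (λ m → X (taylor (suc m) bs)) (λ m → taylor m bs) a)
                        (+ₚ-congʳ H (≋-sym (linear-hornerₚ X-linear M (λ m → taylor (suc m) bs) a)))

module CharacteristicZero {c₀ ℓ : Level} (F : Field c₀ ℓ) (χ : Poly.CharZero F) where
  open Field F hiding (zero)
  open Poly F
  open Polynomials F
  open import Algebra.Properties.Group +-group using (identityʳ-unique; x∙y⁻¹≈ε⇒x≈y)

  *-cancelˡ-nonzero : ∀ x {y z} → ¬ (x ≈ 0#) → x * y ≈ x * z → y ≈ z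
  *-cancelˡ-nonzero x {y} {z} x≉0 e = begin
    y              ≈⟨ trans (*-congʳ x⁻¹x≈1) (*-identityˡ y) ⟨
    (x⁻¹ * x) * y  ≈⟨ trans (*-assoc _ _ _) (*-congˡ e) ⟩
    x⁻¹ * (x * z)  ≈⟨ *-assoc _ _ _ ⟨
    (x⁻¹ * x) * z  ≈⟨ trans (*-congʳ x⁻¹x≈1) (*-identityˡ z) ⟩
    z              ∎
    where open ≈-Reasoning
          x⁻¹ : Carrier
          x⁻¹ = inv x x≉0
          x⁻¹x≈1 : x⁻¹ * x ≈ 1#
          x⁻¹x≈1 = trans (*-comm _ _) (inverse x x≉0)

  natK-+ : ∀ m n → natK (m +ℕ n) ≈ natK m + natK n
  natK-+ zero    n = sym (+-identityˡ _)
  natK-+ (suc m) n = trans (+-congˡ (natK-+ m n)) (sym (+-assoc _ _ _))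

  -- If p has the roots k, k+1, …, then p / (x − k) has the roots k+1, k+2, …; induct on the length.
  roots-from⇒≋[] : ∀ m p k → length p ≡ m → (∀ j → eval p (natK (k +ℕ j)) ≈ 0#) → p ≋ []
  roots-from⇒≋[] m       []       k _   _     = ≋-refl
  roots-from⇒≋[] (suc m) (b ∷ bs) k len roots =
    quotientBy-≋[] c b bs (roots-from⇒≋[] m q (suc k) len-q q-roots) root-c
    where
    c : Carrier
    c = natK k
    q : Pol
    q = quotientBy c bs
    len-q : length q ≡ m
    len-q = ≡.trans (length-quotientBy c bs) (ℕ.suc-injective len)
    root-c : eval (b ∷ bs) c ≈ 0#
    root-c = ≡.subst (λ i → eval (b ∷ bs) (natK i) ≈ 0#) (ℕ.+-identityʳ k) (roots 0)
    q-root : ∀ j → eval q (natK (k +ℕ suc j)) ≈ 0#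
    q-root j = *-cancelˡ-nonzero (natK (suc j)) (χ j)
                 (trans (identityʳ-unique (c * Q) (natK (suc j) * Q) cQ+nQ≈cQ) (sym (zeroʳ _)))
      where
      open ≈-Reasoning
      a Q : Carrier
      a = natK (k +ℕ suc j)
      Q = eval q a
      cQ+nQ≈cQ : c * Q + natK (suc j) * Q ≈ c * Q
      cQ+nQ≈cQ = begin
        c * Q + natK (suc j) * Q   ≈⟨ distribʳ Q c (natK (suc j)) ⟨
        (c + natK (suc j)) * Q     ≈⟨ *-congʳ (natK-+ k (suc j)) ⟨
        a * Q                      ≈⟨ trans (+-congˡ root-c) (+-identityʳ _) ⟨
        a * Q + eval (b ∷ bs) c    ≈⟨ eval-quotientBy c a b bs ⟨
        eval (b ∷ bs) a + c * Q    ≈⟨ trans (+-congʳ (roots (suc j))) (+-identityˡ _) ⟩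
        c * Q                      ∎
    q-roots : ∀ j → eval q (natK (suc k +ℕ j)) ≈ 0#
    q-roots j = ≡.subst (λ i → eval q (natK i) ≈ 0#) (ℕ.+-suc k j) (q-root j)

  eval-on-ℕ-injective : ∀ p q → (∀ j → eval p (natK j) ≈ eval q (natK j)) → p ≋ q
  eval-on-ℕ-injective p q agree = coeffwise λ n → x∙y⁻¹≈ε⇒x≈y _ _
    (trans (sym (trans (coeff-+ₚ p (negₚ q) n) (+-congˡ (coeff-negₚ q n)))) (at difference≋[] n))
    where
    difference≋[] : p +ₚ negₚ q ≋ []
    difference≋[] = roots-from⇒≋[] _ (p +ₚ negₚ q) 0 ≡.refl λ j →
      trans (eval-+ₚ p (negₚ q) (natK j)) (trans (+-congˡ (eval-negₚ q (natK j)))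
        (trans (+-congʳ (agree j)) (-‿inverseʳ _)))

  ≋-from-D : ∀ {r q} → coeff r 0 ≈ coeff q 0 → D r ≋ D q → r ≋ q
  ≋-from-D {r} {q} r₀≈q₀ Dr≋Dq = coeffwise λ where
      zero    → r₀≈q₀
      (suc j) → *-cancelˡ-nonzero (natK (suc j)) (χ j)
                  (trans (sym (coeff-D r j)) (trans (at Dr≋Dq j) (coeff-D q j)))

  hornerₚ-on-ℕ-injective : ∀ M g h → (∀ j → hornerₚ M g (natK j) ≋ hornerₚ M h (natK j)) →
                           ∀ m → m < M → g m ≋ h m
  hornerₚ-on-ℕ-injective M g h agree m m<M = coeffwise λ n →
    ≡.subst₂ _≈_ (coeff-applyUpTo (gₙ n) M m m<M) (coeff-applyUpTo (hₙ n) M m m<M)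
      (at (eval-on-ℕ-injective (applyUpTo (gₙ n) M) (applyUpTo (hₙ n) M) λ j →
             trans (sym (coeff-hornerₚ M g (natK j) n)) (trans (at (agree j) n) (coeff-hornerₚ M h (natK j) n)))
          m)
    where
    gₙ hₙ : ℕ → ℕ → Carrier
    gₙ n i = coeff (g i) n
    hₙ n i = coeff (h i) n

  shiftInvariant⇒commutesWith-taylor : ∀ {T} → Linear T → (∀ a p → T (shift a p) ≋ shift a (T p)) →
                                        ∀ m → T CommutesWith taylor m
  shiftInvariant⇒commutesWith-taylor {T} LT invariant m p =
    hornerₚ-on-ℕ-injective M (λ i → T (taylor i p)) (λ i → taylor i (T p)) (expansions ∘ natK) m m<M
    where
    M : ℕ
    M = suc m +ℕ (length p +ℕ length (T p))
    m<M : m < M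
    m<M = s≤s (ℕ.m≤m+n m _)
    expansions : ∀ a → hornerₚ M (λ i → T (taylor i p)) a ≋ hornerₚ M (λ i → taylor i (T p)) a
    expansions a = begin
      hornerₚ M (λ i → T (taylor i p)) a   ≈⟨ linear-hornerₚ LT M (λ i → taylor i p) a ⟨
      T (hornerₚ M (λ i → taylor i p) a)   ≈⟨ Linear.≋-cong LT (shift≋taylorExpansion a p M
                                                (ℕ.m≤n⇒m≤o+n (suc m) (ℕ.m≤m+n _ _))) ⟨
      T (shift a p)                        ≈⟨ invariant a p ⟩
      shift a (T p)                        ≈⟨ shift≋taylorExpansion a (T p) M
                                                (ℕ.m≤n⇒m≤o+n (suc m) (ℕ.m≤n+m _ (length p))) ⟩
      hornerₚ M (λ i → taylor i (T p)) a   ∎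
      where open ≋-Reasoning

  invFact-suc : ∀ k → invFact χ (suc k) * natK (suc k) ≈ invFact χ k
  invFact-suc k = trans (*-assoc _ _ _)
    (trans (*-congˡ (trans (*-comm _ _) (inverse _ (χ k)))) (*-identityʳ _))

  expTerm : ℕ → Op
  expTerm k r = scale (invFact χ k) (iter X k r)

  expTerm-linear : ∀ k → Linear (expTerm k)
  expTerm-linear k = ∘-linear (scale-linear (invFact χ k)) (iter-linear X-linear k)

  coeff₀-expTerm-suc : ∀ k q → coeff (expTerm (suc k) q) 0 ≈ 0#
  coeff₀-expTerm-suc k q = trans (coeff-scale (invFact χ (suc k)) (iter X (suc k) q) 0) (zeroʳ _)

  D-expTerm : ∀ k q → D (expTerm (suc k) q) ≋ expTerm (suc k) (D q) +ₚ expTerm k q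
  D-expTerm k q = begin
    D (scale i′ (iter X (suc k) q))
      ≈⟨ Linear.homogeneous D-linear i′ (iter X (suc k) q) ⟩
    scale i′ (D (iter X (suc k) q))
      ≈⟨ scale-congˡ (D-iterX k q) ⟩
    scale i′ (iter X (suc k) (D q) +ₚ scale n (Xᵏq))
      ≈⟨ scale-distrib-+ₚ i′ (iter X (suc k) (D q)) (scale n (Xᵏq)) ⟩
    expTerm (suc k) (D q) +ₚ scale i′ (scale n (Xᵏq))
      ≈⟨ +ₚ-congˡ (expTerm (suc k) (D q)) (scale-assoc i′ n (Xᵏq)) ⟩
    expTerm (suc k) (D q) +ₚ scale (i′ * n) (Xᵏq)
      ≈⟨ +ₚ-congˡ (expTerm (suc k) (D q)) (scale-congʳ Xᵏq (invFact-suc k)) ⟩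
    expTerm (suc k) (D q) +ₚ expTerm k q
      ∎
    where open ≋-Reasoning
          i′ n : Carrier
          i′ = invFact χ (suc k)
          n  = natK (suc k)
          Xᵏq : Pol
          Xᵏq = iter X k q

  module DeltaOperator {P : Op} (δ : IsDelta P) where
    open IsDelta δ

    P-linear : Linear P
    P-linear = isLinear⇒Linear linear

    P-commutesWith-D : P CommutesWith D
    P-commutesWith-D p = begin
      P (D p)           ≈⟨ Linear.≋-cong P-linear (taylor-1 p) ⟨
      P (taylor 1 p)    ≈⟨ shiftInvariant⇒commutesWith-taylor P-linear (λ a p → coeffwise (shiftInv a p)) 1 p ⟩
      taylor 1 (P p)    ≈⟨ taylor-1 (P p) ⟩
      D (P p)           ∎
      where open ≋-Reasoning

    Q : Op
    Q = P −ₒ D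

    Q-linear : Linear Q
    Q-linear = −ₒ-linear P-linear D-linear

    P-commutesWith-iterQ : ∀ k → P CommutesWith iter Q k
    P-commutesWith-iterQ = commutesWith-iter Q-linear
      (commutesWith-−ₒ P-linear (λ p → ≋-refl) P-commutesWith-D)

    D+ₚQ≋P : ∀ r → D r +ₚ Q r ≋ P r
    D+ₚQ≋P r = begin
      D r +ₚ (P r +ₚ negₚ (D r))   ≈⟨ +ₚ-leftComm (D r) (P r) (negₚ (D r)) ⟩
      P r +ₚ (D r +ₚ negₚ (D r))   ≈⟨ +ₚ-congˡ (P r) (+ₚ-inverseʳ (D r)) ⟩
      P r +ₚ []                    ≈⟨ +ₚ-identityʳ (P r) ⟩
      P r                          ∎
      where open ≋-Reasoning

    P-lowersDegree : ∀ m {p} → DegreeBelow (suc m) p → DegreeBelow m (P p)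
    P-lowersDegree = linear-lowersDegree P-linear mono mono-hasDeg lowersMono
      where
      lowersMono : ∀ n → DegreeBelow n (P (mono n))
      lowersMono zero    = ≋[]⇒degreeBelow (coeffwise (killsConst 1#))
      lowersMono (suc n) = hasDeg⇒degreeBelow (degReduce (mono (suc n)) n (mono-hasDeg (suc n)))

    Q-lowersDegree : ∀ m {p} → DegreeBelow (suc m) p → DegreeBelow m (Q p)
    Q-lowersDegree m dp = degreeBelow-+ₚ (P-lowersDegree m dp) (degreeBelow-negₚ (degreeBelow-D dp))

    iterQ-vanishes : ∀ k {p} → DegreeBelow k p → iter Q k p ≋ []
    iterQ-vanishes k dp =
      degreeBelow-zero (lowers k 0 (degreeBelow-weaken (ℕ.≤-reflexive (≡.sym (ℕ.+-identityʳ k))) dp))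
      where
      lowers : ∀ k m {p} → DegreeBelow (k +ℕ m) p → DegreeBelow m (iter Q k p)
      lowers zero    m dp = dp
      lowers (suc k) m dp =
        Q-lowersDegree m (lowers k (suc m) (degreeBelow-weaken (ℕ.≤-reflexive (≡.sym (ℕ.+-suc k m))) dp))

    seriesWith : Op → ℕ → Op
    seriesWith R N p = sumₚ N (λ k → expTerm k (R (iter Q k p)))

    series : ℕ → Op
    series = seriesWith (λ r → r)

    series-linear : ∀ N → Linear (series N)
    series-linear N = sumₚ-linear N (λ k → expTerm k ∘ iter Q k) λ k →
      ∘-linear (expTerm-linear k) (iter-linear Q-linear k)

    D-series : ∀ N p → D (series (suc N) p) ≋ seriesWith D (suc N) p +ₚ seriesWith Q N p
    D-series zero    p = ≋-trans (Linear.homogeneous D-linear (invFact χ 0) p) (≋-sym (+ₚ-identityʳ _))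
    D-series (suc N) p = begin
      D (series (suc N) p +ₚ expTerm (suc N) q)                    ≈⟨ Linear.additive D-linear (series (suc N) p) _ ⟩
      D (series (suc N) p) +ₚ D (expTerm (suc N) q)                ≈⟨ +ₚ-cong (D-series N p) (D-expTerm N q) ⟩
      (seriesWith D (suc N) p +ₚ seriesWith Q N p) +ₚ (expTerm (suc N) (D q) +ₚ expTerm N q)
        ≈⟨ +ₚ-interchange (seriesWith D (suc N) p) (seriesWith Q N p) (expTerm (suc N) (D q)) (expTerm N q) ⟩
      (seriesWith D (suc N) p +ₚ expTerm (suc N) (D q)) +ₚ (seriesWith Q N p +ₚ expTerm N q) ∎
      where open ≋-Reasoning
            q : Pol
            q = iter Q (suc N) p

    D-series-P : ∀ N {p} → DegreeBelow (suc N) p → D (series (suc N) p) ≋ series (suc N) (P p)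
    D-series-P N {p} dp = begin
      D (series (suc N) p)                               ≈⟨ D-series N p ⟩
      seriesWith D (suc N) p +ₚ seriesWith Q N p         ≈⟨ +ₚ-congˡ (seriesWith D (suc N) p) extend ⟩
      seriesWith D (suc N) p +ₚ seriesWith Q (suc N) p   ≈⟨ sumₚ-+ₚ (suc N) (summand D) (summand Q) ⟨
      sumₚ (suc N) (λ k → summand D k +ₚ summand Q k)    ≈⟨ sumₚ-cong (suc N) (λ k _ → D+Q-summand k) ⟩
      series (suc N) (P p)                               ∎
      where
      open ≋-Reasoning
      summand : Op → ℕ → Pol
      summand R k = expTerm k (R (iter Q k p))
      extend : seriesWith Q N p ≋ seriesWith Q (suc N) p
      extend = ≋-sym (≋-trans
        (+ₚ-congˡ (seriesWith Q N p) (linear-≋[] (expTerm-linear N) (iterQ-vanishes (suc N) dp)))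
        (+ₚ-identityʳ _))
      D+Q-summand : ∀ k → summand D k +ₚ summand Q k ≋ expTerm k (iter Q k (P p))
      D+Q-summand k = begin
        expTerm k (D q) +ₚ expTerm k (Q q)   ≈⟨ Linear.additive (expTerm-linear k) (D q) (Q q) ⟨
        expTerm k (D q +ₚ Q q)               ≈⟨ Linear.≋-cong (expTerm-linear k) (D+ₚQ≋P q) ⟩
        expTerm k (P q)                      ≈⟨ Linear.≋-cong (expTerm-linear k) (P-commutesWith-iterQ k p) ⟩
        expTerm k (iter Q k (P p))           ∎
        where q : Pol
              q = iter Q k p

    coeff₀-series : ∀ N p → coeff (series (suc N) p) 0 ≈ coeff p 0
    coeff₀-series zero    p = trans (coeff-scale (invFact χ 0) p 0) (*-identityˡ _)
    coeff₀-series (suc N) p = begin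
      coeff (series (suc N) p +ₚ expTerm (suc N) (iter Q (suc N) p)) 0
        ≈⟨ coeff-+ₚ (series (suc N) p) _ 0 ⟩
      coeff (series (suc N) p) 0 + coeff (expTerm (suc N) (iter Q (suc N) p)) 0
        ≈⟨ +-cong (coeff₀-series N p) (coeff₀-expTerm-suc N (iter Q (suc N) p)) ⟩
      coeff p 0 + 0#
        ≈⟨ +-identityʳ _ ⟩
      coeff p 0 ∎
      where open ≈-Reasoning

    module BasicSequence {s : ℕ → Pol} (β : IsBasicSeq P s) where
      open IsBasicSeq β

      s-degreeBelow : ∀ {n N} → n < N → DegreeBelow N (s n)
      s-degreeBelow {n} n<N = degreeBelow-weaken n<N (hasDeg⇒degreeBelow (degree n))

      series-basic : ∀ N n → n < N → series N (s n) ≋ mono n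
      series-basic (suc N) zero    0<N = ≋-from-D (trans (coeff₀-series N (s 0)) (s₀ 0)) (begin
        D (series (suc N) (s 0))   ≈⟨ D-series-P N (s-degreeBelow 0<N) ⟩
        series (suc N) (P (s 0))   ≈⟨ linear-≋[] (series-linear (suc N)) P[s₀]≋[] ⟩
        []                         ∎)
        where open ≋-Reasoning
              P[s₀]≋[] : P (s 0) ≋ []
              P[s₀]≋[] = ≋-trans (Linear.≋-cong P-linear (coeffwise s₀)) (coeffwise (killsConst 1#))
      series-basic (suc N) (suc m) m+1<N+1 = ≋-from-D (trans (coeff₀-series N (s (suc m))) (at0 m)) (begin
        D (Sₙ (s (suc m)))              ≈⟨ D-series-P N (s-degreeBelow m+1<N+1) ⟩
        Sₙ (P (s (suc m)))              ≈⟨ Linear.≋-cong (series-linear (suc N)) (coeffwise (Ps m)) ⟩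
        Sₙ (scale (natK (suc m)) (s m)) ≈⟨ Linear.homogeneous (series-linear (suc N)) (natK (suc m)) (s m) ⟩
        scale (natK (suc m)) (Sₙ (s m)) ≈⟨ scale-congˡ (series-basic (suc N) m (ℕ.<⇒≤ m+1<N+1)) ⟩
        scale (natK (suc m)) (mono m)   ≈⟨ D-mono m ⟨
        D (mono (suc m))                ∎)
        where open ≋-Reasoning
              Sₙ : Op
              Sₙ = series (suc N)


mainTheorem14 : ∀ {c ℓ} (F : Field c ℓ) → let open Poly F in
    (χ : CharZero) (P U : Op) (s : ℕ → Pol) →
    IsDelta P → IsBasicSeq P s →
    IsLinear U → (∀ n → U (s n) ≈ₚ mono n) →
    ∀ (p : Pol) (N : ℕ) → length p ≤ N →
    U p ≈ₚ sumₚ N (λ k → scale (invFact χ k) (iter X k (iter (P −ₒ D) k p)))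
mainTheorem14 F χ P U s δ β U-linear Usₙ≈xⁿ p N len =
  at (linear-agree (isLinear⇒Linear U-linear) (series-linear N) s degree N
        (λ n n<N → ≋-trans (coeffwise (Usₙ≈xⁿ n)) (≋-sym (series-basic N n n<N)))
        (degreeBelow-weaken len (degreeBelow-length p)))
  where
  open Poly F using (module IsBasicSeq)
  open Polynomials F
  open CharacteristicZero F χ
  open DeltaOperator δ
  open BasicSequence β
  open IsBasicSeq β
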